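{- Let ${\cal A}\subset\mathbb{Z}^2$ be an optimal anticode of diameter $d$ in the grid graph ${\cal G}_2$. Then ${\cal A}$ is both vertically contiguous and horizontally contiguous.
   Context: The grid graph ${\cal G}_2$ has vertex set $\mathbb{Z}^2$, with $z,z'$ adjacent iff their $L_1$-distance $d(z,z')$ equals $1$. A set ${\cal A}\subset\mathbb{Z}^2$ is an anticode of diameter $d$ if $d(z_1,z_2)\le d$ for all $z_1,z_2\in{\cal A}$; it is optimal if it has largest possible cardinality among anticodes of diameter $d$. A set ${\cal S}\subseteq\mathbb{Z}^2$ is vertically contiguous if whenever $(x,y_1),(x,y_2)\in{\cal S}$, also $(x,y)\in{\cal S}$ for all $y$ with $\min\{y_1,y_2\}\le y\le\max\{y_1,y_2\}$; horizontally contiguous is defined analogously with the roles of the coordinates exchanged. -}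

module Defs where

open import Data.Nat using (ℕ; _≤_)
open import Data.Integer as ℤ using (ℤ; ∣_∣; _-_)
open import Data.Product using (_×_; _,_)
open import Data.List using (List; length)
open import Data.List.Membership.Propositional using (_∈_)
open import Data.List.Relation.Unary.Unique.Propositional using (Unique)

Point : Set
Point = ℤ × ℤ

-- L1 distance (graph distance in the grid graph G_2)
dist : Point → Point → ℕ
dist (x₁ , y₁) (x₂ , y₂) = ∣ x₁ - x₂ ∣ Data.Nat.+ ∣ y₁ - y₂ ∣
  where import Data.Nat

-- A finite subset of Z^2, given by a duplicate-free list of its elements.
-- (Every anticode of diameter d is finite, so nothing is lost.)
record FinSet : Set where
  constructor mkFinSet
  field
    elems  : List Point
    unique : Unique elems
open FinSet public

_∈ˢ_ : Point → FinSet → Set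
z ∈ˢ S = z ∈ elems S

card : FinSet → ℕ
card S = length (elems S)

IsAnticode : ℕ → FinSet → Set
IsAnticode d A = ∀ {z₁ z₂} → z₁ ∈ˢ A → z₂ ∈ˢ A → dist z₁ z₂ ≤ d

IsOptimalAnticode : ℕ → FinSet → Set
IsOptimalAnticode d A = IsAnticode d A × (∀ B → IsAnticode d B → card B ≤ card A)

VerticallyContiguous : FinSet → Set
VerticallyContiguous S =
  ∀ x y₁ y₂ y → (x , y₁) ∈ˢ S → (x , y₂) ∈ˢ S →
  y₁ ℤ.⊓ y₂ ℤ.≤ y → y ℤ.≤ y₁ ℤ.⊔ y₂ → (x , y) ∈ˢ S

HorizontallyContiguous : FinSet → Set
HorizontallyContiguous S =
  ∀ y x₁ x₂ x → (x₁ , y) ∈ˢ S → (x₂ , y) ∈ˢ S →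
  x₁ ℤ.⊓ x₂ ℤ.≤ x → x ℤ.≤ x₁ ℤ.⊔ x₂ → (x , y) ∈ˢ S

module Submission where

open import Defs
open import Data.Nat as ℕ using (ℕ; z≤n)
import Data.Nat.Properties as ℕ
open import Data.Integer as ℤ using (0ℤ; ∣_∣; _-_; _⊓_; _⊔_; +≤+)
import Data.Integer.Properties as ℤ
open import Data.Product using (_×_; _,_)
open import Data.Product.Properties using (≡-dec)
open import Data.Sum as Sum using (_⊎_; inj₁; inj₂)
open import Data.List using (_∷_)
open import Data.List.Relation.Unary.Any using (here; there)
open import Data.List.Relation.Unary.All.Properties using (¬Any⇒All¬)
open import Data.List.Relation.Unary.AllPairs using (_∷_)
open import Data.List.Membership.DecPropositional (≡-dec ℤ._≟_ ℤ._≟_) using (_∈?_)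
open import Relation.Nullary using (yes; no)
open import Relation.Nullary.Negation using (contradiction)
open import Relation.Binary.PropositionalEquality using (_≡_; refl; sym; subst; subst₂; cong₂)

-- If a point q lies between two points of A on a vertical or horizontal
-- line, then every point of A is at most as far from q as from one of those two points,
-- hence within distance d of q. Adding q would give a larger anticode, so by
-- optimality q already belongs to A.

0≤i⇒i≤j⇒∣i∣≤∣j∣ : ∀ {i j} → 0ℤ ℤ.≤ i → i ℤ.≤ j → ∣ i ∣ ℕ.≤ ∣ j ∣
0≤i⇒i≤j⇒∣i∣≤∣j∣ (+≤+ _) (+≤+ m≤n) = m≤n

∣a-y∣≤∣a-z∣-above : ∀ {a y z} → a ℤ.≤ y → y ℤ.≤ z → ∣ a - y ∣ ℕ.≤ ∣ a - z ∣
∣a-y∣≤∣a-z∣-above {a} {y} {z} a≤y y≤z =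
  subst₂ ℕ._≤_ (ℤ.∣i-j∣≡∣j-i∣ y a) (ℤ.∣i-j∣≡∣j-i∣ z a)
    (0≤i⇒i≤j⇒∣i∣≤∣j∣ (ℤ.i≤j⇒0≤j-i a≤y) (ℤ.+-monoˡ-≤ (ℤ.- a) y≤z))

∣a-y∣≤∣a-z∣-below : ∀ {a y z} → z ℤ.≤ y → y ℤ.≤ a → ∣ a - y ∣ ℕ.≤ ∣ a - z ∣
∣a-y∣≤∣a-z∣-below {a} z≤y y≤a =
  0≤i⇒i≤j⇒∣i∣≤∣j∣ (ℤ.i≤j⇒0≤j-i y≤a) (ℤ.+-monoʳ-≤ a (ℤ.neg-mono-≤ z≤y))

one-of-the-endpoints : ∀ a {y m y₁ y₂} → ∣ a - y ∣ ℕ.≤ ∣ a - m ∣ → m ≡ y₁ ⊎ m ≡ y₂ →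
  ∣ a - y ∣ ℕ.≤ ∣ a - y₁ ∣ ⊎ ∣ a - y ∣ ℕ.≤ ∣ a - y₂ ∣
one-of-the-endpoints _ h (inj₁ refl) = inj₁ h
one-of-the-endpoints _ h (inj₂ refl) = inj₂ h

-- Whichever side of y the integer a lies on, the endpoint beyond y is farther from a.
closer-than-an-endpoint : ∀ a {y₁ y₂ y} → y₁ ⊓ y₂ ℤ.≤ y → y ℤ.≤ y₁ ⊔ y₂ →
  ∣ a - y ∣ ℕ.≤ ∣ a - y₁ ∣ ⊎ ∣ a - y ∣ ℕ.≤ ∣ a - y₂ ∣
closer-than-an-endpoint a {y₁} {y₂} {y} min≤y y≤max with ℤ.≤-total a y
... | inj₁ a≤y = one-of-the-endpoints a (∣a-y∣≤∣a-z∣-above a≤y y≤max) (ℤ.⊔-sel y₁ y₂)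
... | inj₂ y≤a = one-of-the-endpoints a (∣a-y∣≤∣a-z∣-below min≤y y≤a) (ℤ.⊓-sel y₁ y₂)

dist-comm : ∀ z w → dist z w ≡ dist w z
dist-comm (a , b) (c , e) = cong₂ ℕ._+_ (ℤ.∣i-j∣≡∣j-i∣ a c) (ℤ.∣i-j∣≡∣j-i∣ b e)

dist-self : ∀ z → dist z z ≡ 0
dist-self (a , b) rewrite ℤ.i≡j⇒i-j≡0 {a} refl | ℤ.i≡j⇒i-j≡0 {b} refl = refl

optimal-anticode-contains-near-points : ∀ {d} A q → IsOptimalAnticode d A →
  (∀ {z} → z ∈ˢ A → dist z q ℕ.≤ d) → q ∈ˢ A
optimal-anticode-contains-near-points {d} A q (anticode , optimal) near
  with q ∈? elems A
... | yes q∈A = q∈A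
... | no q∉A = contradiction (optimal A∪q A∪q-anticode) (ℕ.<⇒≱ ℕ.≤-refl)
  where
  A∪q : FinSet
  A∪q = mkFinSet (q ∷ elems A) (¬Any⇒All¬ (elems A) q∉A ∷ unique A)

  A∪q-anticode : IsAnticode d A∪q
  A∪q-anticode (here refl) (here refl) = subst (ℕ._≤ d) (sym (dist-self q)) z≤n
  A∪q-anticode (here refl) (there z∈A) = subst (ℕ._≤ d) (dist-comm _ q) (near z∈A)
  A∪q-anticode (there z∈A) (here refl) = near z∈A
  A∪q-anticode (there z∈A) (there w∈A) = anticode z∈A w∈A

optimal-anticode-contains-between-points : ∀ {d p₁ p₂} A q → IsOptimalAnticode d A →
  p₁ ∈ˢ A → p₂ ∈ˢ A → (∀ z → dist z q ℕ.≤ dist z p₁ ⊎ dist z q ℕ.≤ dist z p₂) →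
  q ∈ˢ A
optimal-anticode-contains-between-points A q opt@(anticode , _) p₁∈A p₂∈A between =
  optimal-anticode-contains-near-points A q opt λ {z} z∈A →
    Sum.[ (λ h → ℕ.≤-trans h (anticode z∈A p₁∈A))
        , (λ h → ℕ.≤-trans h (anticode z∈A p₂∈A)) ]′ (between z)

lemma2 : (d : ℕ) (A : FinSet) → IsOptimalAnticode d A →
    VerticallyContiguous A × HorizontallyContiguous A
lemma2 d A opt = vertically , horizontally
  where
  vertically : VerticallyContiguous A
  vertically x y₁ y₂ y p₁∈A p₂∈A min≤y y≤max =
    optimal-anticode-contains-between-points A (x , y) opt p₁∈A p₂∈A λ (a , b) →
      Sum.map (ℕ.+-monoʳ-≤ ∣ a - x ∣) (ℕ.+-monoʳ-≤ ∣ a - x ∣)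
        (closer-than-an-endpoint b min≤y y≤max)

  horizontally : HorizontallyContiguous A
  horizontally y x₁ x₂ x p₁∈A p₂∈A min≤x x≤max =
    optimal-anticode-contains-between-points A (x , y) opt p₁∈A p₂∈A λ (a , b) →
      Sum.map (ℕ.+-monoˡ-≤ ∣ b - y ∣) (ℕ.+-monoˡ-≤ ∣ b - y ∣)
        (closer-than-an-endpoint a min≤x x≤max)
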